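{- Let $b>2$ be an integer and $d$ a positive integer, and let $p$ be the smallest prime such that $p\mid (b-1)$ and $p\nmid d$. Then for any positive integers $n$ and $t$ such that $n+jd$ is $b$-anti-Niven for all $0\leq j\leq t-1$, we have $t\leq p-1$.
   Context: For a positive integer $n$ with base-$b$ expansion $n=\sum_{j=0}^m a_jb^j$ ($0\leq a_j\leq b-1$), $s_b(n)=\sum_{j=0}^m a_j$. A positive integer $n$ is $b$-anti-Niven if $\gcd(n,s_b(n))=1$. (The statement implicitly assumes such a prime $p$ exists.) -}

module Defs where

open import Data.Nat using (ℕ; zero; suc; _+_; _*_; _∸_; _/_; _%_)
open import Data.Nat.GCD using (gcd)
open import Relation.Binary.PropositionalEquality using (_≡_)

-- Digit sum of n in base (2 + c), computed with fuel (fuel ≥ n suffices,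
-- since each step divides by a base ≥ 2).
digitSumAux : ℕ → ℕ → ℕ → ℕ
digitSumAux c zero    n = 0
digitSumAux c (suc f) zero = 0
digitSumAux c (suc f) n@(suc _) =
  n % suc (suc c) + digitSumAux c f (n / suc (suc c))

sumDigits : ℕ → ℕ → ℕ
sumDigits c n = digitSumAux c n n

AntiNiven : ℕ → ℕ → Set
AntiNiven c n = gcd n (sumDigits c n) ≡ 1

{-# OPTIONS --safe #-}
-- Since b ≡ 1 (mod p), every m satisfies s_b(m) ≡ m (mod p). Since p ∤ d,
-- d is invertible mod p, so p divides m = n + jd for some j < p; then p also
-- divides s_b(m), hence gcd(m, s_b(m)), and m is not anti-Niven.
module Submission where

open import Defs
open import Data.Nat using (ℕ; zero; suc; pred; _+_; _*_; _∸_; _<_; _≤_; _/_; _%_; z≤n; s≤s; NonZero; nonTrivial⇒≢1)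
open import Data.Nat.Properties
open import Data.Nat.DivMod
open import Data.Nat.Divisibility using (_∣_; divides; ∣m+n∣m⇒∣n; ∣1⇒≡1; n∣m*n; m%n≡0⇒n∣m; n∣m⇒m%n≡0)
open import Data.Nat.GCD using (gcd-greatest; module Bézout)
open import Data.Nat.Coprimality using (Coprime; coprime-Bézout)
open import Data.Nat.Primality using (Prime; prime⇒irreducible; prime⇒nonZero; prime⇒nonTrivial)
open import Data.Nat.Solver using (module +-*-Solver)
open import Data.Product using (∃-syntax; _×_; _,_)
open import Data.Sum using (inj₁; inj₂)
open import Data.Empty using (⊥; ⊥-elim)
open import Relation.Nullary using (¬_)
open import Relation.Binary.PropositionalEquality
open +-*-Solver
open ≡-Reasoning

%-congʳ-+ : ∀ {p} .{{_ : NonZero p}} r {a b} → a % p ≡ b % p → (r + a) % p ≡ (r + b) % p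
%-congʳ-+ {p} r {a} {b} a≡b = begin
  (r + a) % p           ≡⟨ %-distribˡ-+ r a p ⟩
  (r % p + a % p) % p   ≡⟨ cong (λ z → (r % p + z) % p) a≡b ⟩
  (r % p + b % p) % p   ≡⟨ %-distribˡ-+ r b p ⟨
  (r + b) % p           ∎

-- The base is 2 + c, so p ∣ suc c says that the base is ≡ 1 (mod p).
%-base≡1 : ∀ {c p} .{{_ : NonZero p}} → p ∣ suc c →
           ∀ r q → (r + q * suc (suc c)) % p ≡ (r + q) % p
%-base≡1 {c} {p} (divides k 1+c≡kp) r q = begin
  (r + q * suc (suc c)) % p   ≡⟨ %-congˡ (solve 3 (λ r q c → r :+ q :* (con 2 :+ c) := r :+ q :+ q :* (con 1 :+ c)) refl r q c) ⟩
  (r + q + q * suc c) % p     ≡⟨ cong (λ z → (r + q + q * z) % p) 1+c≡kp ⟩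
  (r + q + q * (k * p)) % p   ≡⟨ %-congˡ (cong (r + q +_) (*-assoc q k p)) ⟨
  (r + q + q * k * p) % p     ≡⟨ [m+kn]%n≡m%n (r + q) (q * k) p ⟩
  (r + q) % p                 ∎

digitSumAux≡[mod] : ∀ {c p} .{{_ : NonZero p}} → p ∣ suc c →
                    ∀ f m → m ≤ f → digitSumAux c f m % p ≡ m % p
digitSumAux≡[mod] p∣c+1 zero    zero z≤n = refl
digitSumAux≡[mod] p∣c+1 (suc f) zero _   = refl
digitSumAux≡[mod] {c} {p} p∣c+1 (suc f) m@(suc m-1) (s≤s m-1≤f) = begin
  (m % B + digitSumAux c f (m / B)) % p   ≡⟨ %-congʳ-+ (m % B) (digitSumAux≡[mod] p∣c+1 f (m / B) m/B≤f) ⟩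
  (m % B + m / B) % p                     ≡⟨ %-base≡1 p∣c+1 (m % B) (m / B) ⟨
  (m % B + m / B * B) % p                 ≡⟨ %-congˡ (m≡m%n+[m/n]*n m B) ⟨
  m % p                                   ∎
  where
  B = suc (suc c)
  m/B≤f : m / B ≤ f
  m/B≤f = ≤-trans (≤-pred (m/n<m m B (s≤s (s≤s z≤n)))) m-1≤f

sumDigits≡[mod] : ∀ {c p} .{{_ : NonZero p}} → p ∣ suc c → ∀ m → sumDigits c m % p ≡ m % p
sumDigits≡[mod] p∣c+1 m = digitSumAux≡[mod] p∣c+1 m m ≤-refl

prime-∣⇒¬AntiNiven : ∀ {c p m} → Prime p → p ∣ suc c → p ∣ m → ¬ AntiNiven c m
prime-∣⇒¬AntiNiven {c} {p} {m} pp p∣c+1 p∣m gcd≡1 =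
  nonTrivial⇒≢1 {{prime⇒nonTrivial pp}} (∣1⇒≡1 (subst (p ∣_) gcd≡1 (gcd-greatest p∣m p∣sm)))
  where
  instance
    p≢0 : NonZero p
    p≢0 = prime⇒nonZero pp
  p∣sm : p ∣ sumDigits c m
  p∣sm = m%n≡0⇒n∣m _ p (trans (sumDigits≡[mod] p∣c+1 m) (n∣m⇒m%n≡0 m p p∣m))

prime-∤⇒coprime : ∀ {p d} → Prime p → ¬ p ∣ d → Coprime d p
prime-∤⇒coprime pp p∤d (i∣d , i∣p) with prime⇒irreducible pp i∣p
... | inj₁ i≡1 = i≡1
... | inj₂ refl = ⊥-elim (p∤d i∣d)

-- From a Bézout identity x d ≡ ±1 (mod p), the multiplier k = ∓ n x works.
coprime⇒∃[k]∣n+k*d : ∀ {p d} .{{_ : NonZero p}} → Coprime d p → ∀ n → ∃[ k ] p ∣ n + k * d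
coprime⇒∃[k]∣n+k*d {p} {d} cop n with coprime-Bézout cop
... | Bézout.+- x y 1+yp≡xd = u * x , divides (n + u * y) (begin
  n + u * x * d                 ≡⟨ cong (n +_) (*-assoc u x d) ⟩
  n + u * (x * d)               ≡⟨ cong (λ z → n + u * z) 1+yp≡xd ⟨
  n + u * (1 + y * p)           ≡⟨ solve 5 (λ n a x y p → n :+ a :* n :* (con 1 :+ y :* p) := (con 1 :+ a) :* n :+ a :* n :* y :* p) refl n (pred p) x y p ⟩
  suc (pred p) * n + u * y * p  ≡⟨ cong (λ z → z * n + u * y * p) (suc-pred p) ⟩
  p * n + u * y * p             ≡⟨ solve 4 (λ n v y p → p :* n :+ v :* y :* p := (n :+ v :* y) :* p) refl n u y p ⟩
  (n + u * y) * p               ∎)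
  where
  u = pred p * n
... | Bézout.-+ x y 1+xd≡yp = n * x , divides (n * y) (begin
  n + n * x * d             ≡⟨ solve 3 (λ n x d → n :+ n :* x :* d := n :* (con 1 :+ x :* d)) refl n x d ⟩
  n * (1 + x * d)           ≡⟨ cong (n *_) 1+xd≡yp ⟩
  n * (y * p)               ≡⟨ *-assoc n y p ⟨
  n * y * p                 ∎)

∣n+k*d⇒∣n+[k%p]*d : ∀ {p} .{{_ : NonZero p}} n k d → p ∣ n + k * d → p ∣ n + (k % p) * d
∣n+k*d⇒∣n+[k%p]*d {p} n k d p∣n+kd = ∣m+n∣m⇒∣n (subst (p ∣_) split p∣n+kd) (n∣m*n (k / p * d))
  where
  split : n + k * d ≡ k / p * d * p + (n + k % p * d)
  split = begin
    n + k * d                       ≡⟨ cong (λ z → n + z * d) (m≡m%n+[m/n]*n k p) ⟩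
    n + (k % p + k / p * p) * d     ≡⟨ solve 5 (λ n r q p d → n :+ (r :+ q :* p) :* d := q :* d :* p :+ (n :+ r :* d)) refl n (k % p) (k / p) p d ⟩
    k / p * d * p + (n + k % p * d) ∎

prime-∤⇒∃[j<p]∣n+j*d : ∀ {p d} → Prime p → ¬ p ∣ d → ∀ n → ∃[ j ] j < p × p ∣ n + j * d
prime-∤⇒∃[j<p]∣n+j*d {p} {d} pp p∤d n = reduce (coprime⇒∃[k]∣n+k*d (prime-∤⇒coprime pp p∤d) n)
  where
  instance
    p≢0 : NonZero p
    p≢0 = prime⇒nonZero pp
  reduce : ∃[ k ] p ∣ n + k * d → ∃[ j ] j < p × p ∣ n + j * d
  reduce (k , p∣n+kd) = k % p , m%n<n k p , ∣n+k*d⇒∣n+[k%p]*d n k d p∣n+kd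

antiNiven-run<p : ∀ {c d p} → Prime p → p ∣ suc c → ¬ p ∣ d →
                  ∀ n t → (∀ j → j < t → AntiNiven c (n + j * d)) → t < p
antiNiven-run<p {c} {d} {p} pp p∣c+1 p∤d n t antiNiven = ≰⇒> p≰t
  where
  p≰t : ¬ p ≤ t
  p≰t p≤t = refute (prime-∤⇒∃[j<p]∣n+j*d pp p∤d n)
    where
    refute : ∃[ j ] j < p × p ∣ n + j * d → ⊥
    refute (j , j<p , p∣n+jd) = prime-∣⇒¬AntiNiven pp p∣c+1 p∣n+jd (antiNiven j (<-≤-trans j<p p≤t))

theorem2p5 : (b d p : ℕ) → 2 < b → 0 < d →
    Prime p → p ∣ (b ∸ 1) → ¬ (p ∣ d) →
    ((q : ℕ) → q < p → Prime q → q ∣ (b ∸ 1) → q ∣ d) →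
    (n t : ℕ) → 0 < n → 0 < t →
    ((j : ℕ) → j < t → AntiNiven (b ∸ 2) (n + j * d)) →
    t ≤ p ∸ 1
theorem2p5 (suc zero) d p (s≤s ()) _ _ _ _ _ n t _ _ _
theorem2p5 (suc (suc c)) d p _ _ pp p∣c+1 p∤d _ n t _ _ antiNiven =
  subst (t ≤_) (pred[m∸n]≡m∸[1+n] p 0) (<⇒≤pred (antiNiven-run<p pp p∣c+1 p∤d n t antiNiven))
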